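{- Let $\mathbb{A}\subseteq\mathbb{B}$ be complete Boolean algebras ($\mathbb{A}$ a complete subalgebra of $\mathbb{B}$), and let $G_0$ be $\mathbb{A}$-generic over $V$. Suppose that in $V[G_0]$ there is a sequence $\langle r_i\mid i<\omega\rangle$ with $r_i\in\mathbb{B}$ and $r_{i+1}/G_0\le_{\mathbb{B}/G_0}r_i/G_0$ for all $i<\omega$. Then in $V[G_0]$ there is a sequence $\langle g_i\mid i<\omega\rangle$ such that for all $i<\omega$, $g_i\in G=\{b\in\mathbb{B}\mid\exists a\in G_0\ a\le b\}$, and, letting $s_i=r_i\wedge g_i$, the sequence $\langle s_i\mid i<\omega\rangle$ is weakly decreasing in $\mathbb{B}$.
   Context: For $b,c\in\mathbb{B}$ write $b\Rightarrow c$ for $\neg b\vee c$. $\mathbb{B}/G_0$ is the set of equivalence classes $b/G_0$ of the relation identifying $b,b'$ iff $(b\Rightarrow b')\wedge(b'\Rightarrow b)\in G$, ordered by $b/G_0\le c/G_0$ iff $(b\Rightarrow c)\in G$. -}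

module Defs where

open import Level using (Level; _⊔_)
open import Data.Product using (Σ; ∃; _×_; _,_)
open import Relation.Nullary using (¬_)
open import Relation.Unary using (Pred; _∈_; _⊆_)
open import Algebra.Lattice.Bundles using (BooleanAlgebra)

module _ {c ℓ : Level} (B : BooleanAlgebra c ℓ) where
  open BooleanAlgebra B renaming (¬_ to ∁_)

  Subset : Set _
  Subset = Pred Carrier (c ⊔ ℓ)

  _≤B_ : Carrier → Carrier → Set ℓ
  x ≤B y = (x ∧ y) ≈ x

  _⇒B_ : Carrier → Carrier → Carrier
  x ⇒B y = (∁ x) ∨ y

  RespectsEq : Subset → Set _
  RespectsEq S = ∀ {x y} → x ≈ y → S x → S y

  IsSup : Subset → Carrier → Set _
  IsSup S s = (∀ x → S x → x ≤B s) × (∀ u → (∀ x → S x → x ≤B u) → s ≤B u)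

  IsComplete : Set _
  IsComplete = ∀ (S : Subset) → ∃ λ s → IsSup S s

  record IsCompleteSubalgebra (A : Subset) : Set (Level.suc (c ⊔ ℓ)) where
    field
      respects : RespectsEq A
      ⊤∈ : ⊤ ∈ A
      ⊥∈ : ⊥ ∈ A
      ∧∈ : ∀ {x y} → x ∈ A → y ∈ A → (x ∧ y) ∈ A
      ∨∈ : ∀ {x y} → x ∈ A → y ∈ A → (x ∨ y) ∈ A
      ∁∈ : ∀ {x} → x ∈ A → (∁ x) ∈ A
      sup∈ : ∀ (S : Subset) → S ⊆ A → ∀ s → IsSup S s → s ∈ A

  IsDense : Subset → Subset → Set _
  IsDense A D = (∀ {d} → D d → A d × ¬ (d ≈ ⊥))
              × (∀ a → A a → ¬ (a ≈ ⊥) → ∃ λ d → D d × d ≤B a)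

  record IsFilterOn (A G₀ : Subset) : Set (c ⊔ ℓ) where
    field
      respects : RespectsEq G₀
      ⊆A : G₀ ⊆ A
      ⊤∈ : ⊤ ∈ G₀
      ⊥∉ : ¬ (⊥ ∈ G₀)
      ∧∈ : ∀ {x y} → x ∈ G₀ → y ∈ G₀ → (x ∧ y) ∈ G₀
      up : ∀ {x y} → x ∈ G₀ → y ∈ A → x ≤B y → y ∈ G₀

  -- G₀ is A-generic over the ground model, where the ground model's
  -- dense subsets of A are given by the family 𝒟
  record IsGeneric {i : Level} {I : Set i} (A : Subset) (𝒟 : I → Subset) (G₀ : Subset)
         : Set (c ⊔ ℓ ⊔ i) where
    field
      filter : IsFilterOn A G₀
      meets : ∀ j → IsDense A (𝒟 j) → ∃ λ x → 𝒟 j x × G₀ x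

  UpClosure : Subset → Subset
  UpClosure G₀ b = ∃ λ a → G₀ a × a ≤B b

  -- the order of B/G₀ :  b/G₀ ≤ c/G₀  iff  (b ⇒ c) ∈ G
  _≤/_[_] : Carrier → Carrier → Subset → Set _
  x ≤/ y [ G₀ ] = UpClosure G₀ (x ⇒B y)

-- Take g₀ = ⊤ and let gₙ be the meet of the implications rₖ₊₁ ⇒ rₖ for k < n.
-- Each implication lies in G by hypothesis and G is closed under finite meets, so
-- gₙ ∈ G; and rₙ₊₁ ∧ gₙ₊₁ ≤ rₙ₊₁ ∧ (rₙ₊₁ ⇒ rₙ) ∧ gₙ ≤ rₙ ∧ gₙ by modus ponens.
module Submission where

open import Defs
open import Level using (Level)
open import Data.Nat using (ℕ; suc; zero)
open import Data.Product using (∃; _×_; _,_; proj₁)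
open import Algebra.Lattice.Bundles using (BooleanAlgebra)
import Algebra.Lattice.Properties.BooleanAlgebra as BooleanAlgebraProperties
import Algebra.Lattice.Properties.Semilattice as SemilatticeProperties
import Relation.Binary.Lattice as OrderLattice
import Relation.Binary.Reasoning.Setoid as SetoidReasoning

module BooleanOrder {c ℓ : Level} (B : BooleanAlgebra c ℓ) where
  open BooleanAlgebra B
  open BooleanAlgebraProperties B using (∧-semilattice; ∨-identityˡ)
  open OrderLattice.MeetSemilattice
    (SemilatticeProperties.∧-orderTheoreticMeetSemilattice ∧-semilattice)
    using ()
    renaming ( _≤_ to _≼_; trans to ≼-trans; reflexive to ≼-reflexive
             ; x∧y≤x to x∧y≼x; x∧y≤y to x∧y≼y; ∧-greatest to ∧-greatest-≼ )
  open SetoidReasoning setoid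

  infix 4 _≤_
  infixr 5 _⇒_

  _≤_ : Carrier → Carrier → Set ℓ
  _≤_ = _≤B_ B

  _⇒_ : Carrier → Carrier → Carrier
  _⇒_ = _⇒B_ B

  -- x ≤ y is x ∧ y ≈ x, the stdlib's natural order x ≼ y is x ≈ x ∧ y.
  ≼⇒≤ : ∀ {x y} → x ≼ y → x ≤ y
  ≼⇒≤ = sym

  ≤⇒≼ : ∀ {x y} → x ≤ y → x ≼ y
  ≤⇒≼ = sym

  ≤-trans : ∀ {x y z} → x ≤ y → y ≤ z → x ≤ z
  ≤-trans p q = ≼⇒≤ (≼-trans (≤⇒≼ p) (≤⇒≼ q))

  x∧y≤x : ∀ x y → x ∧ y ≤ x
  x∧y≤x x y = ≼⇒≤ (x∧y≼x x y)

  x∧y≤y : ∀ x y → x ∧ y ≤ y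
  x∧y≤y x y = ≼⇒≤ (x∧y≼y x y)

  ∧-greatest : ∀ {x y z} → x ≤ y → x ≤ z → x ≤ y ∧ z
  ∧-greatest p q = ≼⇒≤ (∧-greatest-≼ (≤⇒≼ p) (≤⇒≼ q))

  ∧-monotonic : ∀ {x y u v} → x ≤ u → y ≤ v → x ∧ y ≤ u ∧ v
  ∧-monotonic {x} {y} p q =
    ∧-greatest (≤-trans (x∧y≤x x y) p) (≤-trans (x∧y≤y x y) q)

  ≤-reflexive : ∀ {x y} → x ≈ y → x ≤ y
  ≤-reflexive x≈y = ≼⇒≤ (≼-reflexive x≈y)

  ≤-refl : ∀ {x} → x ≤ x
  ≤-refl = ≤-reflexive refl

  x∧[x⇒y]≈x∧y : ∀ x y → x ∧ (x ⇒ y) ≈ x ∧ y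
  x∧[x⇒y]≈x∧y x y = begin
    x ∧ (¬ x ∨ y)        ≈⟨ proj₁ ∧-distrib-∨ x (¬ x) y ⟩
    (x ∧ ¬ x) ∨ (x ∧ y)  ≈⟨ ∨-congʳ (∧-complementʳ x) ⟩
    ⊥ ∨ (x ∧ y)          ≈⟨ ∨-identityˡ (x ∧ y) ⟩
    x ∧ y                ∎

  modus-ponens : ∀ x y → x ∧ (x ⇒ y) ≤ y
  modus-ponens x y = ≤-trans (≤-reflexive (x∧[x⇒y]≈x∧y x y)) (x∧y≤y x y)

module _ {c ℓ : Level} (B : BooleanAlgebra c ℓ) where
  open BooleanAlgebra B
  open BooleanOrder B

  ∧-UpClosure : ∀ {A G₀} → IsFilterOn B A G₀ → ∀ {x y} →
                UpClosure B G₀ x → UpClosure B G₀ y → UpClosure B G₀ (x ∧ y)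
  ∧-UpClosure F (a , a∈G₀ , a≤x) (b , b∈G₀ , b≤y) =
    a ∧ b , IsFilterOn.∧∈ F a∈G₀ b∈G₀ , ∧-monotonic a≤x b≤y

  ⊤-UpClosure : ∀ {A G₀} → IsFilterOn B A G₀ → UpClosure B G₀ ⊤
  ⊤-UpClosure F = ⊤ , IsFilterOn.⊤∈ F , ≤-refl

  implicationMeet : (ℕ → Carrier) → ℕ → Carrier
  implicationMeet r zero    = ⊤
  implicationMeet r (suc n) = implicationMeet r n ∧ (r (suc n) ⇒ r n)

  implicationMeet-UpClosure : ∀ {A G₀} → IsFilterOn B A G₀ → (r : ℕ → Carrier) →
    (∀ n → _≤/_[_] B (r (suc n)) (r n) G₀) →
    ∀ n → UpClosure B G₀ (implicationMeet r n)
  implicationMeet-UpClosure F r r↓ zero    = ⊤-UpClosure F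
  implicationMeet-UpClosure F r r↓ (suc n) =
    ∧-UpClosure F (implicationMeet-UpClosure F r r↓ n) (r↓ n)

  ∧-implicationMeet-decreasing : (r : ℕ → Carrier) → ∀ n →
    r (suc n) ∧ implicationMeet r (suc n) ≤ r n ∧ implicationMeet r n
  ∧-implicationMeet-decreasing r n = ∧-greatest below-r below-g
    where
    x = r (suc n)
    g = implicationMeet r n
    below-r : x ∧ (g ∧ (x ⇒ r n)) ≤ r n
    below-r = ≤-trans (∧-monotonic ≤-refl (x∧y≤y g _)) (modus-ponens x (r n))
    below-g : x ∧ (g ∧ (x ⇒ r n)) ≤ g
    below-g = ≤-trans (x∧y≤y x _) (x∧y≤x g _)

mainTheorem11 : ∀ {c ℓ i : Level} (B : BooleanAlgebra c ℓ) → IsComplete B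
    → (A : Subset B) → IsCompleteSubalgebra B A
    → {I : Set i} (𝒟 : I → Subset B) (G₀ : Subset B) → IsGeneric B A 𝒟 G₀
    → (r : ℕ → BooleanAlgebra.Carrier B)
    → (∀ n → _≤/_[_] B (r (suc n)) (r n) G₀)
    → ∃ λ (g : ℕ → BooleanAlgebra.Carrier B)
        → (∀ n → UpClosure B G₀ (g n))
        × (∀ n → _≤B_ B (BooleanAlgebra._∧_ B (r (suc n)) (g (suc n)))
                        (BooleanAlgebra._∧_ B (r n) (g n)))
mainTheorem11 B _ A _ 𝒟 G₀ generic r r↓ =
    implicationMeet B r
  , implicationMeet-UpClosure B (IsGeneric.filter generic) r r↓
  , ∧-implicationMeet-decreasing B r
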